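{- Let $m > 1$ be an integer and $k \ge 1$ an integer. If $\nu_2(m)$ is odd and $k$ is even, then $S_k(m)$ is empty.
   Context: For a positive integer $x$, $\nu_2(x)$ denotes the largest integer $e$ such that $2^e$ divides $x$. For a positive integer $m$, consider the positive rational solutions $(x,y)$ of $x^y = y^{mx}$. For an integer $k \ge 1$, $S_k(m)$ denotes the set of such solutions with $x \neq 1$, $y \neq 1$, for which $y = x^{a/b}$ with $a, b$ coprime positive integers satisfying $|a - b| = k$. -}

module Defs where

open import Data.Nat as ℕ using (ℕ; zero; suc; _<_; _≤_)
open import Data.Nat.Divisibility using (_∣_)
open import Data.Nat.Coprimality using (Coprime)
open import Data.Integer as ℤ using (ℤ)
open import Data.Rational as ℚ using (ℚ; 1ℚ; 0ℚ; _*_; ↥_; ↧ₙ_)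
open import Data.Product using (Σ; _×_; ∃; ∃-syntax)
open import Relation.Nullary using (¬_)
open import Relation.Binary.PropositionalEquality using (_≡_; _≢_)

Odd : ℕ → Set
Odd n = ∃[ j ] n ≡ suc (2 ℕ.* j)

Even : ℕ → Set
Even n = ∃[ j ] n ≡ 2 ℕ.* j

ν₂≡ : ℕ → ℕ → Set
ν₂≡ m e = (2 ℕ.^ e) ∣ m × ¬ ((2 ℕ.^ suc e) ∣ m)

_^ℚ_ : ℚ → ℕ → ℚ
x ^ℚ zero  = 1ℚ
x ^ℚ suc n = x * (x ^ℚ n)

numℕ : ℚ → ℕ
numℕ r = ℤ.∣ ↥ r ∣

-- For positive rationals x, y, r, s, the real equation  x^r = y^s  is
-- equivalent (raise both sides to the power den(r)·den(s), positive reals)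
-- to the rational equation  x^(num r · den s) = y^(num s · den r).
PowEq : ℚ → ℚ → ℚ → ℚ → Set
PowEq x r y s = x ^ℚ (numℕ r ℕ.* ↧ₙ s) ≡ y ^ℚ (numℕ s ℕ.* ↧ₙ r)

_·ℚ_ : ℕ → ℚ → ℚ
m ·ℚ x = (ℤ.+ m ℚ./ 1) * x

InS : ℕ → ℕ → ℚ → ℚ → Set
InS k m x y =
  ℚ.Positive x × ℚ.Positive y × x ≢ 1ℚ × y ≢ 1ℚ ×
  PowEq x y y (m ·ℚ x) ×
  Σ ℕ λ a → Σ ℕ λ b →
    0 < a × 0 < b × Coprime a b ×
    -- y = x^(a/b)  ⇔  y^b = x^a  (for positive x, y)
    y ^ℚ b ≡ x ^ℚ a ×
    ℤ.∣ ℤ.+ a ℤ.- ℤ.+ b ∣ ≡ k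

{-# OPTIONS --safe #-}
-- Since a − b = ±k is even and gcd(a, b) = 1, both a
-- and b are odd. Raising x^y = y^(mx) to the power b and using y^b = x^a gives x^(yb) = x^(amx),
-- so b·y = a·m·x as x ≠ 1. Taking 2-adic valuations of y^b = x^a and of b·y = a·m·x gives
-- b·ν₂(y) = a·ν₂(x) and ν₂(y) = ν₂(m) + ν₂(x); hence b·ν₂(m) = (a − b)·ν₂(x) is even, and so is
-- ν₂(m) because b is odd.
module Submission where

open import Data.Empty using (⊥-elim)
import Data.Integer as ℤ
open import Data.Integer.GCD using (gcd)
import Data.Integer.Properties as ℤ
open import Data.Nat using (ℕ; zero; suc; _+_; _*_; _^_; _∸_; _<_; _≤_; s≤s; z≤n; NonZero)
open import Data.Nat.Coprimality using (Coprime)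
import Data.Nat.Coprimality as Coprime
open import Data.Nat.Divisibility using (_∣_; divides; ∣m∣n⇒∣m+n)
open import Data.Nat.Induction using (<-rec)
open import Data.Nat.Properties
open import Algebra.Properties.CommutativeSemigroup *-commutativeSemigroup
  using (interchange; xy∙z≈xz∙y; x∙yz≈xz∙y)
open import Data.Nat.Solver using (module +-*-Solver)
open import Data.Product using (_×_; _,_; ∃; ∃-syntax; proj₁; proj₂; map)
open import Data.Rational as ℚ using (ℚ; mkℚ; 1ℚ; ↧ₙ_)
import Data.Rational.Properties as ℚ
open import Algebra.Properties.Monoid.Mult ℚ.*-1-monoid
  using () renaming (_×_ to _×*_; ×-assocˡ to ×*-assocˡ)
open import Data.Sum using (_⊎_; inj₁; inj₂)
open import Function using (_∘_; flip)
open import Relation.Binary.Definitions using (tri<; tri≈; tri>)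
open import Relation.Binary.PropositionalEquality
open import Relation.Nullary using (¬_)

open import Defs

open +-*-Solver
open ≡-Reasoning

private
  variable
    a b d d′ e i j m n n′ u v : ℕ
    x y z : ℚ

parity : ∀ n → Even n ⊎ Odd n
parity zero    = inj₁ (0 , refl)
parity (suc n) with parity n
... | inj₁ (j , refl) = inj₂ (j , refl)
... | inj₂ (j , refl) = inj₁ (suc j , sym (*-distribˡ-+ 2 1 j))

odd⇒¬even : Odd n → ¬ Even n
odd⇒¬even (i , refl) (j , eq) = even≢odd j i (sym eq)

even⇒2∣ : Even n → 2 ∣ n
even⇒2∣ (j , refl) = divides j (*-comm 2 j)

odd-+-even : Odd m → Even n → Odd (m + n)
odd-+-even (i , refl) (j , refl) = i + j , cong suc (sym (*-distribˡ-+ 2 i j))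

odd-* : Odd m → Odd n → Odd (m * n)
odd-* (i , refl) (j , refl) = i + j + 2 * i * j ,
  solve 2 (λ i j → (con 1 :+ con 2 :* i) :* (con 1 :+ con 2 :* j)
                 := con 1 :+ con 2 :* (i :+ j :+ con 2 :* i :* j)) refl i j

+-even⇒even : e + 2 * m ≡ 2 * n → Even e
+-even⇒even {e} {m} {n} eq = n ∸ m , (begin
  e                  ≡⟨ m+n∸n≡m e (2 * m) ⟨
  e + 2 * m ∸ 2 * m  ≡⟨ cong (_∸ 2 * m) eq ⟩
  2 * n ∸ 2 * m      ≡⟨ *-distribˡ-∸ 2 n m ⟨
  2 * (n ∸ m)        ∎)

coprime-+-even⇒odd : Coprime m (m + n) → Even n → Odd m
coprime-+-even⇒odd {m} m⊥m+n n-even with parity m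
... | inj₂ m-odd  = m-odd
... | inj₁ m-even with m⊥m+n (even⇒2∣ m-even , ∣m∣n⇒∣m+n (even⇒2∣ m-even) (even⇒2∣ n-even))
...   | ()

∣m-n∣-split : ∀ m n → m ≡ n + ℤ.∣ ℤ.+ m ℤ.- ℤ.+ n ∣ ⊎ n ≡ m + ℤ.∣ ℤ.+ m ℤ.- ℤ.+ n ∣
∣m-n∣-split m n rewrite ℤ.m-n≡m⊖n m n with ≤-total n m
... | inj₁ n≤m = inj₁ (trans (sym (m+[n∸m]≡n n≤m))
                             (cong (n +_) (sym (trans (ℤ.∣m⊖n∣≡∣n⊖m∣ m n) (ℤ.∣⊖∣-≤ n≤m)))))
... | inj₂ m≤n = inj₂ (trans (sym (m+[n∸m]≡n m≤n)) (cong (m +_) (sym (ℤ.∣⊖∣-≤ m≤n))))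

coprime∧even-distance⇒odd : Coprime a b → Even ℤ.∣ ℤ.+ a ℤ.- ℤ.+ b ∣ → Odd a × Odd b
coprime∧even-distance⇒odd {a} {b} a⊥b even-dist with ∣m-n∣-split a b
... | inj₁ a≡b+δ = subst Odd (sym a≡b+δ) (odd-+-even b-odd even-dist) , b-odd
  where
  b-odd : Odd b
  b-odd = coprime-+-even⇒odd (subst (Coprime b) a≡b+δ (Coprime.sym a⊥b)) even-dist
... | inj₂ b≡a+δ = a-odd , subst Odd (sym b≡a+δ) (odd-+-even a-odd even-dist)
  where
  a-odd : Odd a
  a-odd = coprime-+-even⇒odd (subst (Coprime a) b≡a+δ a⊥b) even-dist

record Val₂ (n i : ℕ) : Set where
  constructor val₂
  field
    oddPart       : ℕ
    oddPart-odd   : Odd oddPart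
    n≡2^i*oddPart : n ≡ 2 ^ i * oddPart

Val₂-odd : Odd n → Val₂ n 0
Val₂-odd {n} n-odd = val₂ n n-odd (sym (*-identityˡ n))

Val₂-* : Val₂ m i → Val₂ n j → Val₂ (m * n) (i + j)
Val₂-* {i = i} {j = j} (val₂ u u-odd refl) (val₂ v v-odd refl) =
  val₂ (u * v) (odd-* u-odd v-odd) (begin
  2 ^ i * u * (2 ^ j * v)  ≡⟨ interchange (2 ^ i) u (2 ^ j) v ⟩
  2 ^ i * 2 ^ j * (u * v)  ≡⟨ cong (_* (u * v)) (^-distribˡ-+-* 2 i j) ⟨
  2 ^ (i + j) * (u * v)    ∎)

Val₂-^ : Val₂ n i → ∀ k → Val₂ (n ^ k) (k * i)
Val₂-^ ν zero    = Val₂-odd (0 , refl)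
Val₂-^ ν (suc k) = Val₂-* ν (Val₂-^ ν k)

Val₂-zero⇒odd : Val₂ n 0 → Odd n
Val₂-zero⇒odd (val₂ u u-odd refl) = subst Odd (sym (*-identityˡ u)) u-odd

Val₂-suc⇒even : Val₂ n (suc i) → Even n
Val₂-suc⇒even {i = i} (val₂ u _ refl) = 2 ^ i * u , *-assoc 2 (2 ^ i) u

Val₂-unique : Val₂ n i → Val₂ n j → i ≡ j
Val₂-unique {i = zero}  {j = zero}  _ _ = refl
Val₂-unique {i = zero}  {j = suc _} ν ν′ = ⊥-elim (odd⇒¬even (Val₂-zero⇒odd ν) (Val₂-suc⇒even ν′))
Val₂-unique {i = suc _} {j = zero}  ν ν′ = ⊥-elim (odd⇒¬even (Val₂-zero⇒odd ν′) (Val₂-suc⇒even ν))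
Val₂-unique {i = suc i} {j = suc j} (val₂ u u-odd refl) (val₂ v v-odd eq) =
  cong suc (Val₂-unique (val₂ u u-odd refl) (val₂ v v-odd (*-cancelˡ-≡ _ _ 2 (begin
    2 * (2 ^ i * u)  ≡⟨ *-assoc 2 (2 ^ i) u ⟨
    2 ^ suc i * u    ≡⟨ eq ⟩
    2 ^ suc j * v    ≡⟨ *-assoc 2 (2 ^ j) v ⟩
    2 * (2 ^ j * v)  ∎))))

Val₂-exists : ∀ n .{{_ : NonZero n}} → ∃ (Val₂ n)
Val₂-exists = <-rec (λ n → .{{_ : NonZero n}} → ∃ (Val₂ n)) step
  where
  step : ∀ n → (∀ {m} → m < n → .{{_ : NonZero m}} → ∃ (Val₂ m)) → .{{_ : NonZero n}} → ∃ (Val₂ n)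
  step n rec with parity n
  ... | inj₂ n-odd      = 0 , Val₂-odd n-odd
  ... | inj₁ (j , refl) = map suc (Val₂-* (val₂ 1 (0 , refl) refl)) (rec j<2j {{j≢0}})
    where
    j≢0 : NonZero j
    j≢0 = m*n≢0⇒n≢0 2
    j<2j : j < 2 * j
    j<2j = subst (j <_) (*-comm j 2) (m<m*n j 2 {{j≢0}} (s≤s (s≤s z≤n)))

ν₂≡⇒Val₂ : ν₂≡ m e → Val₂ m e
ν₂≡⇒Val₂ {e = e} (divides c refl , 2^1+e∤m) with parity c
... | inj₂ c-odd      = val₂ c c-odd (*-comm c (2 ^ e))
... | inj₁ (j , refl) = ⊥-elim (2^1+e∤m (divides j
  (solve 2 (λ j t → con 2 :* j :* t := j :* (con 2 :* t)) refl j (2 ^ e))))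

-- b·e = (a − b)·(p − q), with both sides moved so that no subtraction occurs.
b·e≡[a-b]·[p-q] : ∀ a b e p q r s → b * r + a * q ≡ a * p + b * s → r + q ≡ e + p + s →
  b * e + (b * p + a * q) ≡ a * p + b * q
b·e≡[a-b]·[p-q] a b e p q r s power scaling = +-cancelʳ-≡ (b * r + b * s) _ _ (begin
  b * e + (b * p + a * q) + (b * r + b * s)
    ≡⟨ solve 7 (λ a b e p q r s → b :* e :+ (b :* p :+ a :* q) :+ (b :* r :+ b :* s)
                 := b :* (e :+ p :+ s) :+ (b :* r :+ a :* q)) refl a b e p q r s ⟩
  b * (e + p + s) + (b * r + a * q)  ≡⟨ cong₂ (λ t u → b * t + u) (sym scaling) power ⟩
  b * (r + q) + (a * p + b * s)
    ≡⟨ solve 6 (λ a b p q r s → b :* (r :+ q) :+ (a :* p :+ b :* s)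
                 := a :* p :+ b :* q :+ (b :* r :+ b :* s)) refl a b p q r s ⟩
  a * p + b * q + (b * r + b * s)    ∎)

b·e≡[a-b]·[p-q]⇒even : ∀ p q → Odd a → Odd b → b * e + (b * p + a * q) ≡ a * p + b * q → Even e
b·e≡[a-b]·[p-q]⇒even {a = a} {b = b} {e = e} p q (a′ , refl) (b′ , refl) eq =
  +-even⇒even {m = b′ * e + b′ * p + a′ * q} {n = a′ * p + b′ * q} (+-cancelʳ-≡ (p + q) _ _ (begin
    e + 2 * (b′ * e + b′ * p + a′ * q) + (p + q)
      ≡⟨ solve 5 (λ a′ b′ e p q → e :+ con 2 :* (b′ :* e :+ b′ :* p :+ a′ :* q) :+ (p :+ q)
                   := (con 1 :+ con 2 :* b′) :* e
                      :+ ((con 1 :+ con 2 :* b′) :* p :+ (con 1 :+ con 2 :* a′) :* q))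
             refl a′ b′ e p q ⟩
    b * e + (b * p + a * q)          ≡⟨ eq ⟩
    a * p + b * q
      ≡⟨ solve 4 (λ a′ b′ p q → (con 1 :+ con 2 :* a′) :* p :+ (con 1 :+ con 2 :* b′) :* q
                   := con 2 :* (a′ :* p :+ b′ :* q) :+ (p :+ q)) refl a′ b′ p q ⟩
    2 * (a′ * p + b′ * q) + (p + q)  ∎))

odd-power-relation⇒even-Val₂ :
  ∀ {P Q R S} .{{_ : NonZero P}} .{{_ : NonZero Q}} .{{_ : NonZero R}} .{{_ : NonZero S}} →
  Odd a → Odd b → Val₂ m e →
  R ^ b * Q ^ a ≡ P ^ a * S ^ b → b * R * Q ≡ a * (m * P) * S → Even e
odd-power-relation⇒even-Val₂ {a} {b} {e = e} {P} {Q} {R} {S} a-odd b-odd ν₂m power scaling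
  with Val₂-exists P | Val₂-exists Q | Val₂-exists R | Val₂-exists S
... | p , νP | q , νQ | r , νR | s , νS =
  b·e≡[a-b]·[p-q]⇒even p q a-odd b-odd (b·e≡[a-b]·[p-q] a b e p q r s ν₂-power ν₂-scaling)
  where
  ν₂-power : b * r + a * q ≡ a * p + b * s
  ν₂-power = Val₂-unique (subst (flip Val₂ _) power (Val₂-* (Val₂-^ νR b) (Val₂-^ νQ a)))
                         (Val₂-* (Val₂-^ νP a) (Val₂-^ νS b))
  ν₂-scaling : r + q ≡ e + p + s
  ν₂-scaling = Val₂-unique (subst (flip Val₂ _) scaling (Val₂-* (Val₂-* (Val₂-odd b-odd) νR) νQ))
                           (Val₂-* (Val₂-* (Val₂-odd a-odd) (Val₂-* ν₂m νP)) νS)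

^-injectiveˡ : ∀ k .{{_ : NonZero k}} → m ^ k ≡ n ^ k → m ≡ n
^-injectiveˡ {m} {n} k eq with <-cmp m n
... | tri< m<n _ _ = ⊥-elim (<-irrefl eq (^-monoˡ-< k m<n))
... | tri≈ _ m≡n _ = m≡n
... | tri> _ _ m>n = ⊥-elim (<-irrefl (sym eq) (^-monoˡ-< k m>n))

^-cross-injective : .{{_ : NonZero m}} .{{_ : NonZero n}} →
  m ≢ n → m ^ u * n ^ v ≡ m ^ v * n ^ u → u ≡ v
^-cross-injective {u = zero}  {v = zero}  _ _ = refl
^-cross-injective {m} {n} {zero} {suc v} m≢n eq =
  ⊥-elim (m≢n (^-injectiveˡ (suc v) (trans (sym (*-identityʳ _)) (trans (sym eq) (*-identityˡ _)))))
^-cross-injective {m} {n} {suc u} {zero} m≢n eq =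
  ⊥-elim (m≢n (^-injectiveˡ (suc u) (trans (sym (*-identityʳ _)) (trans eq (*-identityˡ _)))))
^-cross-injective {m} {n} {suc u} {suc v} m≢n eq =
  cong suc (^-cross-injective m≢n (*-cancelˡ-≡ _ _ (m * n) {{m*n≢0 m n}} (begin
    m * n * (m ^ u * n ^ v)    ≡⟨ interchange m n (m ^ u) (n ^ v) ⟩
    m * m ^ u * (n * n ^ v)    ≡⟨ eq ⟩
    m * m ^ v * (n * n ^ u)    ≡⟨ interchange m n (m ^ v) (n ^ u) ⟨
    m * n * (m ^ v * n ^ u)    ∎)))

numℕ-nonZero : ∀ x → ℚ.Positive x → NonZero (numℕ x)
numℕ-nonZero (mkℚ ℤ.+[1+ _ ] _ _) _ = _

numℕ≡↧ₙ⇒≡1 : ∀ x → ℚ.Positive x → numℕ x ≡ ↧ₙ x → x ≡ 1ℚ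
numℕ≡↧ₙ⇒≡1 (mkℚ ℤ.+[1+ n ] d _) _ eq =
  ℚ.≃⇒≡ (ℚ.*≡* (cong ℤ.+_ (trans (*-identityʳ (suc n)) (trans eq (sym (*-identityˡ (suc d)))))))

infix 4 _≈_/_

-- |x| = n / d, cross-multiplied
data _≈_/_ (x : ℚ) (n d : ℕ) : Set where
  *≡* : numℕ x * d ≡ n * ↧ₙ x → x ≈ n / d

≈-num/den : ∀ x → x ≈ numℕ x / ↧ₙ x
≈-num/den x = *≡* refl

≈-cross : x ≈ n / d → x ≈ n′ / d′ → n * d′ ≡ n′ * d
≈-cross {x} {n} {d} {n′} {d′} (*≡* x≈n/d) (*≡* x≈n′/d′) = *-cancelʳ-≡ _ _ (↧ₙ x) (begin
  n * d′ * ↧ₙ x       ≡⟨ xy∙z≈xz∙y n d′ (↧ₙ x) ⟩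
  n * ↧ₙ x * d′       ≡⟨ cong (_* d′) x≈n/d ⟨
  numℕ x * d * d′     ≡⟨ xy∙z≈xz∙y (numℕ x) d d′ ⟩
  numℕ x * d′ * d     ≡⟨ cong (_* d) x≈n′/d′ ⟩
  n′ * ↧ₙ x * d       ≡⟨ xy∙z≈xz∙y n′ (↧ₙ x) d ⟩
  n′ * d * ↧ₙ x       ∎)

≈-common-factor : ∀ g {i j} → ℚ.↥ x ℤ.* g ≡ i → ℚ.↧ x ℤ.* g ≡ j → x ≈ ℤ.∣ i ∣ / ℤ.∣ j ∣
≈-common-factor {x} g refl refl = *≡* (begin
  numℕ x * ℤ.∣ ℚ.↧ x ℤ.* g ∣   ≡⟨ cong (numℕ x *_) (ℤ.abs-* (ℚ.↧ x) g) ⟩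
  numℕ x * (↧ₙ x * ℤ.∣ g ∣)    ≡⟨ x∙yz≈xz∙y (numℕ x) (↧ₙ x) ℤ.∣ g ∣ ⟩
  numℕ x * ℤ.∣ g ∣ * ↧ₙ x      ≡⟨ cong (_* ↧ₙ x) (ℤ.abs-* (ℚ.↥ x) g) ⟨
  ℤ.∣ ℚ.↥ x ℤ.* g ∣ * ↧ₙ x     ∎)

*-≈-num/den : ∀ x y → x ℚ.* y ≈ numℕ x * numℕ y / (↧ₙ x * ↧ₙ y)
*-≈-num/den x y =
  subst₂ (x ℚ.* y ≈_/_) (ℤ.abs-* (ℚ.↥ x) (ℚ.↥ y)) (ℤ.abs-* (ℚ.↧ x) (ℚ.↧ y))
  (≈-common-factor {x ℚ.* y} (gcd (ℚ.↥ x ℤ.* ℚ.↥ y) (ℚ.↧ x ℤ.* ℚ.↧ y)) (ℚ.↥-* x y) (ℚ.↧-* x y))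

≈-* : x ≈ n / d → y ≈ n′ / d′ → x ℚ.* y ≈ n * n′ / (d * d′)
≈-* {x} {n} {d} {y} {n′} {d′} (*≡* x≈n/d) (*≡* y≈n′/d′) =
  *≡* (*-cancelʳ-≡ _ _ (↧ₙ x * ↧ₙ y) {{m*n≢0 (↧ₙ x) (↧ₙ y)}} (begin
    N * (d * d′) * (↧ₙ x * ↧ₙ y)    ≡⟨ xy∙z≈xz∙y N (d * d′) (↧ₙ x * ↧ₙ y) ⟩
    N * (↧ₙ x * ↧ₙ y) * (d * d′)    ≡⟨ cong (_* (d * d′)) xy≈ ⟩
    numℕ x * numℕ y * D * (d * d′)  ≡⟨ xy∙z≈xz∙y (numℕ x * numℕ y) D (d * d′) ⟩
    numℕ x * numℕ y * (d * d′) * D  ≡⟨ cong (_* D) (interchange (numℕ x) (numℕ y) d d′) ⟩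
    numℕ x * d * (numℕ y * d′) * D  ≡⟨ cong₂ (λ s t → s * t * D) x≈n/d y≈n′/d′ ⟩
    n * ↧ₙ x * (n′ * ↧ₙ y) * D      ≡⟨ cong (_* D) (interchange n (↧ₙ x) n′ (↧ₙ y)) ⟩
    n * n′ * (↧ₙ x * ↧ₙ y) * D      ≡⟨ xy∙z≈xz∙y (n * n′) (↧ₙ x * ↧ₙ y) D ⟩
    n * n′ * D * (↧ₙ x * ↧ₙ y)      ∎))
  where
  N D : ℕ
  N = numℕ (x ℚ.* y)
  D = ↧ₙ (x ℚ.* y)
  xy≈ : N * (↧ₙ x * ↧ₙ y) ≡ numℕ x * numℕ y * D
  xy≈ = ≈-cross (≈-num/den (x ℚ.* y)) (*-≈-num/den x y)

≈-^ : x ≈ n / d → ∀ k → x ^ℚ k ≈ n ^ k / d ^ k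
≈-^ x≈n/d zero    = *≡* refl
≈-^ x≈n/d (suc k) = ≈-* x≈n/d (≈-^ x≈n/d k)

≈-[m/1] : ∀ m → ℤ.+ m ℚ./ 1 ≈ m / 1
≈-[m/1] m =
  subst (_≈ m / 1) (sym (ℚ.normalize-coprime (Coprime.sym (Coprime.1-coprimeTo m)))) (*≡* refl)

·ℚ-≈ : ∀ m x → m ·ℚ x ≈ m * numℕ x / ↧ₙ x
·ℚ-≈ m x = subst (m ·ℚ x ≈ m * numℕ x /_) (*-identityˡ (↧ₙ x)) (≈-* (≈-[m/1] m) (≈-num/den x))

≈-subst-cross : z ≈ n / d → numℕ y * ↧ₙ z * b ≡ a * (numℕ z * ↧ₙ y) → b * numℕ y * d ≡ a * n * ↧ₙ y
≈-subst-cross {z} {n} {d} {y} {b} {a} (*≡* z≈n/d) eq = *-cancelʳ-≡ _ _ D (begin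
  b * R * d * D    ≡⟨ solve 4 (λ b R d D → b :* R :* d :* D := R :* D :* b :* d) refl b R d D ⟩
  R * D * b * d    ≡⟨ cong (_* d) eq ⟩
  a * (N * S) * d  ≡⟨ solve 4 (λ a N S d → a :* (N :* S) :* d := a :* S :* (N :* d)) refl a N S d ⟩
  a * S * (N * d)  ≡⟨ cong (a * S *_) z≈n/d ⟩
  a * S * (n * D)  ≡⟨ solve 4 (λ a S n D → a :* S :* (n :* D) := a :* n :* S :* D) refl a S n D ⟩
  a * n * S * D    ∎)
  where
  R S N D : ℕ
  R = numℕ y
  S = ↧ₙ y
  N = numℕ z
  D = ↧ₙ z

^ℚ-cross : ∀ x u y v → x ^ℚ u ≡ y ^ℚ v → numℕ x ^ u * ↧ₙ y ^ v ≡ numℕ y ^ v * ↧ₙ x ^ u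
^ℚ-cross x u y v eq =
  ≈-cross (≈-^ (≈-num/den x) u) (subst (_≈ numℕ y ^ v / ↧ₙ y ^ v) (sym eq) (≈-^ (≈-num/den y) v))

^ℚ-injective : ℚ.Positive x → x ≢ 1ℚ → x ^ℚ u ≡ x ^ℚ v → u ≡ v
^ℚ-injective {x} {u} {v} x>0 x≢1 eq =
  ^-cross-injective {{numℕ-nonZero x x>0}} (x≢1 ∘ numℕ≡↧ₙ⇒≡1 x x>0) (^ℚ-cross x u x v eq)

^ℚ≡×* : ∀ x n → x ^ℚ n ≡ n ×* x
^ℚ≡×* x zero    = refl
^ℚ≡×* x (suc n) = cong (x ℚ.*_) (^ℚ≡×* x n)

^ℚ-*-assoc : ∀ x m n → (x ^ℚ m) ^ℚ n ≡ x ^ℚ (m * n)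
^ℚ-*-assoc x m n = begin
  (x ^ℚ m) ^ℚ n  ≡⟨ trans (^ℚ≡×* (x ^ℚ m) n) (cong (n ×*_) (^ℚ≡×* x m)) ⟩
  n ×* (m ×* x)  ≡⟨ ×*-assocˡ x n m ⟩
  (n * m) ×* x   ≡⟨ ^ℚ≡×* x (n * m) ⟨
  x ^ℚ (n * m)   ≡⟨ cong (x ^ℚ_) (*-comm n m) ⟩
  x ^ℚ (m * n)   ∎

^ℚ-exponents : ∀ x r y s b a → x ^ℚ r ≡ y ^ℚ s → y ^ℚ b ≡ x ^ℚ a → x ^ℚ (r * b) ≡ x ^ℚ (a * s)
^ℚ-exponents x r y s b a x^r≡y^s y^b≡x^a = begin
  x ^ℚ (r * b)     ≡⟨ ^ℚ-*-assoc x r b ⟨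
  (x ^ℚ r) ^ℚ b    ≡⟨ cong (_^ℚ b) x^r≡y^s ⟩
  (y ^ℚ s) ^ℚ b    ≡⟨ ^ℚ-*-assoc y s b ⟩
  y ^ℚ (s * b)     ≡⟨ cong (y ^ℚ_) (*-comm s b) ⟩
  y ^ℚ (b * s)     ≡⟨ ^ℚ-*-assoc y b s ⟨
  (y ^ℚ b) ^ℚ s    ≡⟨ cong (_^ℚ s) y^b≡x^a ⟩
  (x ^ℚ a) ^ℚ s    ≡⟨ ^ℚ-*-assoc x a s ⟩
  x ^ℚ (a * s)     ∎

x^y≡y^mx⇒b·y≡a·mx : ∀ x y m a b → ℚ.Positive x → x ≢ 1ℚ →
  PowEq x y y (m ·ℚ x) → y ^ℚ b ≡ x ^ℚ a → b * numℕ y * ↧ₙ x ≡ a * (m * numℕ x) * ↧ₙ y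
x^y≡y^mx⇒b·y≡a·mx x y m a b x>0 x≢1 x^y≡y^mx y^b≡x^a = ≈-subst-cross {y = y} {b} {a} (·ℚ-≈ m x)
  (^ℚ-injective x>0 x≢1 (^ℚ-exponents x (numℕ y * ↧ₙ (m ·ℚ x)) y (numℕ (m ·ℚ x) * ↧ₙ y) b a
                                      x^y≡y^mx y^b≡x^a))

lemma4 : (m k : ℕ) → 1 < m → 1 ≤ k →
    (∃[ e ] (ν₂≡ m e × Odd e)) → Even k →
    (x y : ℚ) → ¬ InS k m x y
lemma4 m k _ _ (e , ν₂m≡e , e-odd) k-even x y
       (x>0 , y>0 , x≢1 , _ , x^y≡y^mx , a , b , _ , _ , a⊥b , y^b≡x^a , ∣a-b∣≡k) =
  odd⇒¬even e-odd
    (odd-power-relation⇒even-Val₂ a-odd b-odd (ν₂≡⇒Val₂ ν₂m≡e) (^ℚ-cross y b x a y^b≡x^a)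
      (x^y≡y^mx⇒b·y≡a·mx x y m a b x>0 x≢1 x^y≡y^mx y^b≡x^a))
  where
  instance
    numx≢0 : NonZero (numℕ x)
    numx≢0 = numℕ-nonZero x x>0
    numy≢0 : NonZero (numℕ y)
    numy≢0 = numℕ-nonZero y y>0
  a-odd×b-odd : Odd a × Odd b
  a-odd×b-odd = coprime∧even-distance⇒odd a⊥b (subst Even (sym ∣a-b∣≡k) k-even)
  a-odd : Odd a
  a-odd = proj₁ a-odd×b-odd
  b-odd : Odd b
  b-odd = proj₂ a-odd×b-odd
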